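{- For all nonnegative integers $n$ and $\ell$, the number of partitions of $n$ with exactly $\ell$ parts equals the number of partitions $\lambda$ into distinct parts such that $\lambda_1+\lambda_3+\lambda_5+\cdots=n$ and $|\lambda|=2n-\ell$.
   Context: A partition is a weakly decreasing sequence of nonnegative integers $\lambda=(\lambda_1,\lambda_2,\dots)$, eventually zero; its parts are its nonzero terms, $|\lambda|$ is the sum of its parts, and $\lambda_i=0$ for $i$ larger than the number of parts. A partition has distinct parts if no nonzero value is repeated. -}

module Defs where

open import Data.Nat using (ℕ; zero; suc; _+_; _<_; _≥_; _>_)
open import Data.List using (List; []; _∷_; length)
open import Data.Nat.ListAction using (sum)
open import Data.List.Relation.Unary.All using (All)
open import Data.List.Relation.Unary.Linked using (Linked)
open import Data.Product using (Σ; _×_)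
open import Relation.Binary.PropositionalEquality using (_≡_)

IsPartition : List ℕ → Set
IsPartition xs = All (λ x → x > 0) xs × Linked _≥_ xs

IsDistinctPartition : List ℕ → Set
IsDistinctPartition xs = All (λ x → x > 0) xs × Linked _>_ xs

size : List ℕ → ℕ
size = sum

-- λ₁ + λ₃ + λ₅ + ⋯ (sum of parts in odd positions, 1-indexed)
oddSum : List ℕ → ℕ
oddSum []           = 0
oddSum (x ∷ [])     = x
oddSum (x ∷ _ ∷ xs) = x + oddSum xs

PartitionsWithParts : ℕ → ℕ → Set
PartitionsWithParts n ℓ =
  Σ (List ℕ) λ xs → IsPartition xs × (size xs ≡ n) × (length xs ≡ ℓ)

-- The set of distinct-part partitions λ with λ₁+λ₃+⋯ = n and |λ| = 2n - ℓ.
-- (|λ| = 2n ∸ ℓ is expressed as |λ| + ℓ = 2n.)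
DistinctOddSum : ℕ → ℕ → Set
DistinctOddSum n ℓ =
  Σ (List ℕ) λ xs → IsDistinctPartition xs × (oddSum xs ≡ n) × (size xs + ℓ ≡ n + n)

-- Read a partition λ into distinct parts as the hook lengths
-- λ₁ = h(1,1), λ₂ = h(1,2), λ₃ = h(2,2), λ₄ = h(2,3), … of a partition μ,
-- i.e. of its diagonal cells and their right neighbours (a missing neighbour
-- has hook length 0). The hooks h(1,1) and h(1,2) determine the first row and
-- the first column of μ, and λ₃, λ₄, … are the same hooks of μ with its first
-- row and column removed, so every partition μ arises from exactly one λ. The
-- diagonal hooks partition the cells of μ, so |μ| = λ₁ + λ₃ + ⋯, and
-- h(1,1) − h(1,2) is the number of rows of μ minus that of the smaller
-- partition, so ℓ(μ) = λ₁ − λ₂ + λ₃ − ⋯; hence |λ| = 2|μ| − ℓ(μ).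
module Submission where

open import Defs
open import Data.Nat using (ℕ; zero; suc; _+_; _∸_; _≤_; _<_; _>_; _≥_; z≤n; s≤s)
open import Data.Nat.Properties
open import Data.Nat.Induction using (<-wellFounded)
open import Data.Nat.Tactic.RingSolver using (solve-∀)
open import Data.List using (List; []; _∷_; length; map; _++_; replicate)
open import Data.List.Properties using (∷-injective; length-replicate)
open import Data.List.Relation.Unary.All as All using (All; []; _∷_)
open import Data.List.Relation.Unary.Linked as Linked using (Linked; []; [-]; _∷_)
open import Data.Product using (∃; ∃₂; _×_; _,_; proj₁)
open import Data.Empty using (⊥-elim)
open import Induction.WellFounded using (Acc; acc)
open import Relation.Binary.PropositionalEquality
open import Function.Bundles using (_⤖_; mk⤖)
open import Function.Properties.Bijection using (sym-≡)

open ≡-Reasoning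

firstPart : List ℕ → ℕ
firstPart []      = 0
firstPart (x ∷ _) = x

strictBound : List ℕ → ℕ
strictBound []      = 0
strictBound (x ∷ _) = suc x

evenSum : List ℕ → ℕ
evenSum []           = 0
evenSum (_ ∷ [])     = 0
evenSum (_ ∷ y ∷ xs) = y + evenSum xs

size≡oddSum+evenSum : ∀ xs → size xs ≡ oddSum xs + evenSum xs
size≡oddSum+evenSum []           = refl
size≡oddSum+evenSum (x ∷ [])     = refl
size≡oddSum+evenSum (x ∷ y ∷ xs) = begin
  x + (y + size xs)                  ≡⟨ cong (λ s → x + (y + s)) (size≡oddSum+evenSum xs) ⟩
  x + (y + (oddSum xs + evenSum xs)) ≡⟨ regroup x y (oddSum xs) (evenSum xs) ⟩
  x + oddSum xs + (y + evenSum xs)   ∎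
  where
  regroup : ∀ x y o e → x + (y + (o + e)) ≡ x + o + (y + e)
  regroup = solve-∀

linked-∷ : ∀ {x xs} → firstPart xs ≤ x → Linked _≥_ xs → Linked _≥_ (x ∷ xs)
linked-∷ {xs = []}    _   _  = [-]
linked-∷ {xs = _ ∷ _} x≥y ys = x≥y ∷ ys

linked⇒firstPart≤ : ∀ {x xs} → Linked _≥_ (x ∷ xs) → firstPart xs ≤ x
linked⇒firstPart≤ [-]       = z≤n
linked⇒firstPart≤ (x≥y ∷ _) = x≥y

strictlyLinked-∷ : ∀ {x xs} → strictBound xs ≤ x → Linked _>_ xs → Linked _>_ (x ∷ xs)
strictlyLinked-∷ {xs = []}    _   _  = [-]
strictlyLinked-∷ {xs = _ ∷ _} x>y ys = x>y ∷ ys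

strictlyLinked⇒strictBound≤ : ∀ {x xs} → Linked _>_ (x ∷ xs) → strictBound xs ≤ x
strictlyLinked⇒strictBound≤ [-]       = z≤n
strictlyLinked⇒strictBound≤ (x>y ∷ _) = x>y

addColumn : List ℕ → ℕ → List ℕ
addColumn ν j = map suc ν ++ replicate j 1

size-addColumn : ∀ ν j → size (addColumn ν j) ≡ size ν + length ν + j
size-addColumn []      zero    = refl
size-addColumn []      (suc j) = cong suc (size-addColumn [] j)
size-addColumn (y ∷ ν) j       = begin
  suc y + size (addColumn ν j)    ≡⟨ cong (suc y +_) (size-addColumn ν j) ⟩
  suc y + (size ν + length ν + j) ≡⟨ regroup y (size ν) (length ν) j ⟩
  y + size ν + suc (length ν) + j ∎
  where
  regroup : ∀ y s l j → suc y + (s + l + j) ≡ y + s + suc l + j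
  regroup = solve-∀

length-addColumn : ∀ ν j → length (addColumn ν j) ≡ length ν + j
length-addColumn []      j = length-replicate j
length-addColumn (_ ∷ ν) j = cong suc (length-addColumn ν j)

firstPart-addColumn-≤ : ∀ ν j {d} → firstPart ν ≤ d → firstPart (addColumn ν j) ≤ suc d
firstPart-addColumn-≤ []      zero    _   = z≤n
firstPart-addColumn-≤ []      (suc j) _   = s≤s z≤n
firstPart-addColumn-≤ (_ ∷ _) _       y≤d = s≤s y≤d

firstPart-addColumn-≤⁻¹ : ∀ ν j {d} → firstPart (addColumn ν j) ≤ suc d → firstPart ν ≤ d
firstPart-addColumn-≤⁻¹ []      _ _         = z≤n
firstPart-addColumn-≤⁻¹ (_ ∷ _) _ (s≤s y≤d) = y≤d

addColumn-positive : ∀ ν j → All (_> 0) (addColumn ν j)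
addColumn-positive []      zero    = []
addColumn-positive []      (suc j) = s≤s z≤n ∷ addColumn-positive [] j
addColumn-positive (_ ∷ ν) j       = s≤s z≤n ∷ addColumn-positive ν j

addColumn-linked : ∀ {ν} j → Linked _≥_ ν → Linked _≥_ (addColumn ν j)
addColumn-linked {[]}    zero    _  = []
addColumn-linked {[]}    (suc j) _  = linked-∷ (firstPart-addColumn-≤ [] j z≤n) (addColumn-linked j [])
addColumn-linked {_ ∷ ν} j       lk =
  linked-∷ (firstPart-addColumn-≤ ν j (linked⇒firstPart≤ lk)) (addColumn-linked j (Linked.tail lk))

cons-addColumn-isPartition : ∀ {c ν} j → firstPart ν < c → IsPartition ν →
                             IsPartition (c ∷ addColumn ν j)
cons-addColumn-isPartition {ν = ν} j (s≤s ν₁≤d) (_ , lk) =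
  s≤s z≤n ∷ addColumn-positive ν j ,
  linked-∷ (firstPart-addColumn-≤ ν j ν₁≤d) (addColumn-linked j lk)

addColumn-injective : ∀ {ν ν'} j j' → All (_> 0) ν → All (_> 0) ν' →
                      addColumn ν j ≡ addColumn ν' j' → ν ≡ ν' × j ≡ j'
addColumn-injective j       j'      []          []          eq =
  refl , trans (sym (length-replicate j)) (trans (cong length eq) (length-replicate j'))
addColumn-injective zero    _       []          (s≤s _ ∷ _) ()
addColumn-injective (suc _) _       []          (s≤s _ ∷ _) ()
addColumn-injective _       zero    (s≤s _ ∷ _) []          ()
addColumn-injective _       (suc _) (s≤s _ ∷ _) []          ()
addColumn-injective j       j'      (_ ∷ pos)   (_ ∷ pos')  eq with ∷-injective eq
... | y≡y' , rest with addColumn-injective j j' pos pos' rest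
... | refl , refl = cong (_∷ _) (suc-injective y≡y') , refl

removeFirstColumn : ∀ μ → IsPartition μ → ∃₂ λ ν j → IsPartition ν × μ ≡ addColumn ν j
removeFirstColumn []          _              = [] , 0 , ([] , []) , refl
removeFirstColumn (zero ∷ _)  (() ∷ _ , _)
removeFirstColumn (suc x ∷ μ) (_ ∷ pos , lk) with removeFirstColumn μ (pos , Linked.tail lk)
... | ν , j , (posν , lkν) , refl =
  extend x ν posν lkν (firstPart-addColumn-≤⁻¹ ν j (linked⇒firstPart≤ lk))
  where
  extend : ∀ x ν → All (_> 0) ν → Linked _≥_ ν → firstPart ν ≤ x →
           ∃₂ λ ν' j' → IsPartition ν' × suc x ∷ addColumn ν j ≡ addColumn ν' j'
  extend zero    []      _         _   _    = [] , suc j , ([] , []) , refl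
  extend zero    (_ ∷ _) (0<y ∷ _) _   y≤0  = ⊥-elim (<⇒≱ 0<y y≤0)
  extend (suc x) ν       posν      lkν ν₁≤x =
    suc x ∷ ν , j , (s≤s z≤n ∷ posν , linked-∷ ν₁≤x lkν) , refl

-- With ν = fromHooks l, h(1,2) = λ₂ forces μ₁ = λ₂ + 1 − ℓ(ν), and h(1,1) = λ₁
-- leaves λ₁ − λ₂ − 1 rows of length one; for distinct λ both subtractions are
-- exact (Cons₂View).
fromHooks : List ℕ → List ℕ
fromHooks []          = []
fromHooks (a ∷ [])    = replicate a 1
fromHooks (a ∷ b ∷ l) = (suc b ∸ length (fromHooks l)) ∷ addColumn (fromHooks l) (a ∸ suc b)

fromHooks-cons₂ : ∀ l d j → let b = length (fromHooks l) + d in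
                  fromHooks (suc b + j ∷ b ∷ l) ≡ suc d ∷ addColumn (fromHooks l) j
fromHooks-cons₂ l d j = cong₂ (λ c j → c ∷ addColumn (fromHooks l) j)
  (trans (cong (_∸ k) (sym (+-suc k d))) (m+n∸m≡n k (suc d)))
  (m+n∸m≡n (suc (k + d)) j)
  where
  k = length (fromHooks l)

record HookInvariant (l : List ℕ) : Set where
  field
    isPartition                  : IsPartition (fromHooks l)
    size≡oddSum                  : size (fromHooks l) ≡ oddSum l
    length+evenSum≡oddSum        : length (fromHooks l) + evenSum l ≡ oddSum l
    length+firstPart≡strictBound : length (fromHooks l) + firstPart (fromHooks l) ≡ strictBound l

open HookInvariant

strictBound≤ : ∀ {l d} → HookInvariant l → firstPart (fromHooks l) ≤ d →
               strictBound l ≤ length (fromHooks l) + d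
strictBound≤ {l} {d} I ν₁≤d = subst (_≤ k + d) (length+firstPart≡strictBound I) (+-monoʳ-≤ k ν₁≤d)
  where
  k = length (fromHooks l)

data Cons₂View (l : List ℕ) : ℕ → ℕ → Set where
  cons₂ : ∀ d j → firstPart (fromHooks l) ≤ d →
          Cons₂View l (suc (length (fromHooks l) + d) + j) (length (fromHooks l) + d)

cons₂-view : ∀ {a b l} → HookInvariant l → Linked _>_ (a ∷ b ∷ l) → Cons₂View l a b
cons₂-view {l = l} I (b<a ∷ lk) =
  view (subst (_≤ _) (sym (length+firstPart≡strictBound I)) (strictlyLinked⇒strictBound≤ lk)) b<a
  where
  k = length (fromHooks l)
  view : ∀ {a b} → k + firstPart (fromHooks l) ≤ b → b < a → Cons₂View l a b
  view k+ν₁≤b b<a with m≤n⇒∃[o]m+o≡n (≤-trans (m≤m+n k _) k+ν₁≤b) | m≤n⇒∃[o]m+o≡n b<a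
  ... | d , refl | j , refl = cons₂ d j (+-cancelˡ-≤ k _ _ k+ν₁≤b)

hookInvariant-cons₂ : ∀ {a b l} → Cons₂View l a b → HookInvariant l → HookInvariant (a ∷ b ∷ l)
hookInvariant-cons₂ {l = l} (cons₂ d j ν₁≤d) I = record
  { isPartition =
      subst IsPartition (sym normal) (cons-addColumn-isPartition j (s≤s ν₁≤d) (isPartition I))
  ; size≡oddSum = begin
      size μ                        ≡⟨ cong size normal ⟩
      suc d + size (addColumn ν j)  ≡⟨ cong (suc d +_) (size-addColumn ν j) ⟩
      suc d + (size ν + k + j)      ≡⟨ cong (λ s → suc d + (s + k + j)) (size≡oddSum I) ⟩
      suc d + (oddSum l + k + j)    ≡⟨ sizeArith d (oddSum l) k j ⟩
      suc (k + d) + j + oddSum l    ∎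
  ; length+evenSum≡oddSum = begin
      length μ + (k + d + evenSum l)
        ≡⟨ cong (λ μ → length μ + (k + d + evenSum l)) normal ⟩
      suc (length (addColumn ν j)) + (k + d + evenSum l)
        ≡⟨ cong (λ m → suc m + (k + d + evenSum l)) (length-addColumn ν j) ⟩
      suc (k + j) + (k + d + evenSum l)
        ≡⟨ lengthArith k j d (evenSum l) ⟩
      suc (k + d) + j + (k + evenSum l)
        ≡⟨ cong (suc (k + d) + j +_) (length+evenSum≡oddSum I) ⟩
      suc (k + d) + j + oddSum l
        ∎
  ; length+firstPart≡strictBound = begin
      length μ + firstPart μ               ≡⟨ cong (λ μ → length μ + firstPart μ) normal ⟩
      suc (length (addColumn ν j)) + suc d ≡⟨ cong (λ m → suc m + suc d) (length-addColumn ν j) ⟩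
      suc (k + j) + suc d                  ≡⟨ hookArith k j d ⟩
      suc (suc (k + d) + j)                ∎
  }
  where
  ν = fromHooks l
  k = length ν
  μ = fromHooks (suc (k + d) + j ∷ k + d ∷ l)
  normal = fromHooks-cons₂ l d j
  sizeArith : ∀ d o k j → suc d + (o + k + j) ≡ suc (k + d) + j + o
  sizeArith = solve-∀
  lengthArith : ∀ k j d e → suc (k + j) + (k + d + e) ≡ suc (k + d) + j + (k + e)
  lengthArith = solve-∀
  hookArith : ∀ k j d → suc (k + j) + suc d ≡ suc (suc (k + d) + j)
  hookArith = solve-∀

hookInvariant : ∀ l → IsDistinctPartition l → HookInvariant l
hookInvariant [] _ = record
  { isPartition                  = [] , []
  ; size≡oddSum                  = refl
  ; length+evenSum≡oddSum        = refl
  ; length+firstPart≡strictBound = refl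
  }
hookInvariant (zero ∷ [])  (() ∷ _ , _)
hookInvariant (suc a ∷ []) _ = record
  { isPartition                  = cons-addColumn-isPartition a (s≤s z≤n) ([] , [])
  ; size≡oddSum                  = cong suc (size-addColumn [] a)
  ; length+evenSum≡oddSum        = trans (+-identityʳ _) (cong suc (length-addColumn [] a))
  ; length+firstPart≡strictBound = trans (+-comm _ 1) (cong (2 +_) (length-addColumn [] a))
  }
hookInvariant (a ∷ b ∷ l) (_ ∷ _ ∷ pos , lk) = hookInvariant-cons₂ (cons₂-view I lk) I
  where
  I = hookInvariant l (pos , Linked.tail (Linked.tail lk))

oddSum+oddSum≡size+length : ∀ {l} → HookInvariant l →
                            oddSum l + oddSum l ≡ size l + length (fromHooks l)
oddSum+oddSum≡size+length {l} I = begin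
  oddSum l + oddSum l          ≡⟨ cong (oddSum l +_) (length+evenSum≡oddSum I) ⟨
  oddSum l + (k + evenSum l)   ≡⟨ regroup (oddSum l) k (evenSum l) ⟩
  oddSum l + evenSum l + k     ≡⟨ cong (_+ k) (size≡oddSum+evenSum l) ⟨
  size l + k                   ∎
  where
  k = length (fromHooks l)
  regroup : ∀ o k e → o + (k + e) ≡ o + e + k
  regroup = solve-∀

strictBound-≡ : ∀ {l l'} → HookInvariant l → HookInvariant l' →
                fromHooks l ≡ fromHooks l' → strictBound l ≡ strictBound l'
strictBound-≡ I I' eq = trans (sym (length+firstPart≡strictBound I))
  (trans (cong (λ μ → length μ + firstPart μ) eq) (length+firstPart≡strictBound I'))

evenSum-≡ : ∀ {l l'} → HookInvariant l → HookInvariant l' →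
            fromHooks l ≡ fromHooks l' → evenSum l ≡ evenSum l'
evenSum-≡ {l} {l'} I I' eq = +-cancelˡ-≡ (length (fromHooks l)) _ _ (begin
  length (fromHooks l) + evenSum l   ≡⟨ length+evenSum≡oddSum I ⟩
  oddSum l                           ≡⟨ size≡oddSum I ⟨
  size (fromHooks l)                 ≡⟨ cong size eq ⟩
  size (fromHooks l')                ≡⟨ size≡oddSum I' ⟩
  oddSum l'                          ≡⟨ length+evenSum≡oddSum I' ⟨
  length (fromHooks l') + evenSum l' ≡⟨ cong (λ μ → length μ + evenSum l') eq ⟨
  length (fromHooks l) + evenSum l'  ∎)

cons₂-injective : ∀ {a b l a' b' l'} → Cons₂View l a b → Cons₂View l' a' b' →
                  HookInvariant l → HookInvariant l' → (fromHooks l ≡ fromHooks l' → l ≡ l') →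
                  fromHooks (a ∷ b ∷ l) ≡ fromHooks (a' ∷ b' ∷ l') →
                  _≡_ {A = List ℕ} (a ∷ b ∷ l) (a' ∷ b' ∷ l')
cons₂-injective {l = l} {l' = l'} (cons₂ d j _) (cons₂ d' j' _) I I' tail-injective eq
  with ∷-injective (trans (sym (fromHooks-cons₂ l d j)) (trans eq (fromHooks-cons₂ l' d' j')))
... | d+1≡d'+1 , columns≡
  with addColumn-injective j j' (proj₁ (isPartition I)) (proj₁ (isPartition I')) columns≡
... | ν≡ν' , refl with tail-injective ν≡ν' | suc-injective d+1≡d'+1
... | refl | refl = refl

fromHooks-injective : ∀ l l' → IsDistinctPartition l → IsDistinctPartition l' →
                      fromHooks l ≡ fromHooks l' → l ≡ l'
fromHooks-injective []          []           _  _   _  = refl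
fromHooks-injective []          (_ ∷ _)      dl dl' eq =
  ⊥-elim (0≢1+n (strictBound-≡ (hookInvariant _ dl) (hookInvariant _ dl') eq))
fromHooks-injective (_ ∷ _)     []           dl dl' eq =
  ⊥-elim (0≢1+n (sym (strictBound-≡ (hookInvariant _ dl) (hookInvariant _ dl') eq)))
fromHooks-injective (_ ∷ [])    (_ ∷ [])     dl dl' eq =
  cong (_∷ []) (suc-injective (strictBound-≡ (hookInvariant _ dl) (hookInvariant _ dl') eq))
-- λ₂ > 0 makes the evenSum of the longer list positive.
fromHooks-injective (_ ∷ [])    (_ ∷ _ ∷ _)  dl dl'@(_ ∷ s≤s _ ∷ _ , _) eq =
  ⊥-elim (0≢1+n (evenSum-≡ (hookInvariant _ dl) (hookInvariant _ dl') eq))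
fromHooks-injective (_ ∷ _ ∷ _) (_ ∷ [])     dl@(_ ∷ s≤s _ ∷ _ , _) dl' eq =
  ⊥-elim (0≢1+n (sym (evenSum-≡ (hookInvariant _ dl) (hookInvariant _ dl') eq)))
fromHooks-injective (a ∷ b ∷ l) (a' ∷ b' ∷ l') (_ ∷ _ ∷ pos , lk) (_ ∷ _ ∷ pos' , lk') =
  cons₂-injective (cons₂-view I lk) (cons₂-view I' lk') I I' (fromHooks-injective l l' dl dl')
  where
  dl  = pos  , Linked.tail (Linked.tail lk)
  dl' = pos' , Linked.tail (Linked.tail lk')
  I   = hookInvariant l dl
  I'  = hookInvariant l' dl'

cons₂-preimage : ∀ {l d} j → IsDistinctPartition l → firstPart (fromHooks l) ≤ d →
                 0 < length (fromHooks l) + d →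
                 ∃ λ l' → IsDistinctPartition l' × fromHooks l' ≡ suc d ∷ addColumn (fromHooks l) j
cons₂-preimage {l} {d} j dl@(pos , lk) ν₁≤d 0<b =
  suc b + j ∷ b ∷ l ,
  (s≤s z≤n ∷ 0<b ∷ pos ,
   m≤m+n (suc b) j ∷ strictlyLinked-∷ (strictBound≤ (hookInvariant l dl) ν₁≤d) lk) ,
  fromHooks-cons₂ l d j
  where
  b = length (fromHooks l) + d

cons-addColumn-preimage : ∀ l d j → IsDistinctPartition l → firstPart (fromHooks l) ≤ d →
                          ∃ λ l' → IsDistinctPartition l' ×
                                   fromHooks l' ≡ suc d ∷ addColumn (fromHooks l) j
cons-addColumn-preimage []      zero    j _  _    = suc j ∷ [] , (s≤s z≤n ∷ [] , [-]) , refl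
cons-addColumn-preimage []      (suc d) j dl ν₁≤d = cons₂-preimage j dl ν₁≤d (s≤s z≤n)
cons-addColumn-preimage (_ ∷ _) d       j dl ν₁≤d =
  cons₂-preimage j dl ν₁≤d (≤-trans (s≤s z≤n) (strictBound≤ (hookInvariant _ dl) ν₁≤d))

fromHooks-surjective : ∀ μ → IsPartition μ → ∃ λ l → IsDistinctPartition l × fromHooks l ≡ μ
fromHooks-surjective μ pμ = preimage μ pμ (<-wellFounded (length μ))
  where
  preimage : ∀ μ → IsPartition μ → Acc _<_ (length μ) →
             ∃ λ l → IsDistinctPartition l × fromHooks l ≡ μ
  preimage []          _              _        = [] , ([] , []) , refl
  preimage (zero ∷ _)  (() ∷ _ , _)   _
  preimage (suc d ∷ μ) (_ ∷ pos , lk) (acc rs) with removeFirstColumn μ (pos , Linked.tail lk)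
  ... | ν , j , pν , refl
    with preimage ν pν (rs (s≤s (subst (length ν ≤_) (sym (length-addColumn ν j)) (m≤m+n _ j))))
  ... | l , dl , refl =
    cons-addColumn-preimage l d j dl (firstPart-addColumn-≤⁻¹ (fromHooks l) j (linked⇒firstPart≤ lk))

PartitionsWithParts-≡ : ∀ {n ℓ} {x y : PartitionsWithParts n ℓ} → proj₁ x ≡ proj₁ y → x ≡ y
PartitionsWithParts-≡ {x = _ , (pos , lk) , s , l} {y = _ , (pos' , lk') , s' , l'} refl
  rewrite All.irrelevant ≤-irrelevant pos pos' | Linked.irrelevant ≤-irrelevant lk lk'
        | ≡-irrelevant s s' | ≡-irrelevant l l' = refl

DistinctOddSum-≡ : ∀ {n ℓ} {x y : DistinctOddSum n ℓ} → proj₁ x ≡ proj₁ y → x ≡ y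
DistinctOddSum-≡ {x = _ , (pos , lk) , o , s} {y = _ , (pos' , lk') , o' , s'} refl
  rewrite All.irrelevant ≤-irrelevant pos pos' | Linked.irrelevant ≤-irrelevant lk lk'
        | ≡-irrelevant o o' | ≡-irrelevant s s' = refl

toPartition : ∀ {n ℓ} → DistinctOddSum n ℓ → PartitionsWithParts n ℓ
toPartition {n} {ℓ} (l , dl , oddSum≡n , size+ℓ≡n+n) =
  fromHooks l , isPartition I , trans (size≡oddSum I) oddSum≡n , sym (+-cancelˡ-≡ (size l) _ _ (begin
    size l + ℓ                     ≡⟨ size+ℓ≡n+n ⟩
    n + n                          ≡⟨ cong₂ _+_ oddSum≡n oddSum≡n ⟨
    oddSum l + oddSum l            ≡⟨ oddSum+oddSum≡size+length I ⟩
    size l + length (fromHooks l)  ∎))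
  where
  I = hookInvariant l dl

toPartition-injective : ∀ {n ℓ} {x y : DistinctOddSum n ℓ} → toPartition x ≡ toPartition y → x ≡ y
toPartition-injective {x = l , dl , _} {y = l' , dl' , _} eq =
  DistinctOddSum-≡ (fromHooks-injective l l' dl dl' (cong proj₁ eq))

toPartition-surjective : ∀ {n ℓ} (y : PartitionsWithParts n ℓ) →
                         ∃ λ x → ∀ {z} → z ≡ x → toPartition z ≡ y
toPartition-surjective {n} {ℓ} (μ , pμ , size≡n , length≡ℓ) with fromHooks-surjective μ pμ
... | l , dl , refl = (l , dl , oddSum≡n , size+ℓ≡n+n) , λ { refl → PartitionsWithParts-≡ refl }
  where
  I = hookInvariant l dl
  oddSum≡n = trans (sym (size≡oddSum I)) size≡n
  size+ℓ≡n+n = begin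
    size l + ℓ                     ≡⟨ cong (size l +_) length≡ℓ ⟨
    size l + length (fromHooks l)  ≡⟨ oddSum+oddSum≡size+length I ⟨
    oddSum l + oddSum l            ≡⟨ cong₂ _+_ oddSum≡n oddSum≡n ⟩
    n + n                          ∎

corollary1 : (n ℓ : ℕ) → PartitionsWithParts n ℓ ⤖ DistinctOddSum n ℓ
corollary1 n ℓ = sym-≡ (mk⤖ {to = toPartition} (toPartition-injective , toPartition-surjective))
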